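{- Let $m$ and $n$ be non-negative integers and let $j$, $r$, $s$ be any integers. Then \[ \sum_{k = 0}^n \binom nk F_{j(2rk + s)}^{2m + 1} = \begin{cases} 5^{ -m} \sum_{i = 0}^m (-1)^{i(js + 1)} \binom{2m + 1}{i} L_{(2m + 1 - 2i)jr}^n F_{(2m + 1 - 2i)(jrn + js)}, & jr \text{ even},\\ 5^{n/2 - m} \sum_{i = 0}^m (-1)^{i(js + 1)} \binom{2m + 1}{i} F_{(2m + 1 - 2i)jr}^n F_{(2m + 1 - 2i)(jrn + js)}, & jr \text{ odd},\ n \text{ even},\\ 5^{(n - 1)/2 - m} \sum_{i = 0}^m (-1)^{i(js + 1)} \binom{2m + 1}{i} F_{(2m + 1 - 2i)jr}^n L_{(2m + 1 - 2i)(jrn + js)}, & jr \text{ odd},\ n \text{ odd}, \end{cases} \] and \[ \sum_{k = 0}^n \binom nk L_{j(2rk + s)}^{2m + 1} = \begin{cases} \sum_{i = 0}^m (-1)^{ijs} \binom{2m + 1}{i} L_{(2m + 1 - 2i)jr}^n L_{(2m + 1 - 2i)(jrn + js)}, & jr \text{ even},\\ 5^{n/2} \sum_{i = 0}^m (-1)^{ijs} \binom{2m + 1}{i} F_{(2m + 1 - 2i)jr}^n L_{(2m + 1 - 2i)(jrn + js)}, & jr \text{ odd},\ n \text{ even},\\ 5^{(n + 1)/2} \sum_{i = 0}^m (-1)^{ijs} \binom{2m + 1}{i} F_{(2m + 1 - 2i)jr}^n F_{(2m + 1 - 2i)(jrn + js)}, & jr \text{ odd},\ n \text{ odd}. \end{cases}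 \]
   Context: The Fibonacci numbers $F_n$ and Lucas numbers $L_n$ are defined for all integers $n$ by $F_0=0$, $F_1=1$, $L_0=2$, $L_1=1$, $F_n=F_{n-1}+F_{n-2}$, $L_n=L_{n-1}+L_{n-2}$, extended to negative indices by $F_{ -n}=(-1)^{n-1}F_n$, $L_{ -n}=(-1)^nL_n$. The convention $0^0=1$ is used. -}

module Defs where

open import Data.Nat as ℕ using (ℕ; zero; suc)
open import Data.Integer as ℤ using (ℤ; +_; -[1+_]; ∣_∣)
open import Data.Rational as ℚ using (ℚ)
open import Data.List using (List; map; upTo; foldr)
open import Data.Nat.Combinatorics using (_C_)

fibℕ : ℕ → ℕ
fibℕ zero = 0
fibℕ (suc zero) = 1
fibℕ (suc (suc n)) = fibℕ (suc n) ℕ.+ fibℕ n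

lucℕ : ℕ → ℕ
lucℕ zero = 2
lucℕ (suc zero) = 1
lucℕ (suc (suc n)) = lucℕ (suc n) ℕ.+ lucℕ n

neg1^ : ℤ → ℤ
neg1^ e = ℤ.-1ℤ ℤ.^ ∣ e ∣

-- F_n, L_n for all integers n, with F_{-n} = (-1)^{n-1} F_n, L_{-n} = (-1)^n L_n
F : ℤ → ℤ
F (+ n) = + fibℕ n
F -[1+ n ] = (ℤ.-1ℤ ℤ.^ n) ℤ.* (+ fibℕ (suc n))

L : ℤ → ℤ
L (+ n) = + lucℕ n
L -[1+ n ] = (ℤ.-1ℤ ℤ.^ suc n) ℤ.* (+ lucℕ (suc n))

binom : ℕ → ℕ → ℤ
binom n k = + (n C k)

sumTo : ℕ → (ℕ → ℤ) → ℤ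
sumTo n f = foldr ℤ._+_ (+ 0) (map f (upTo (suc n)))

_^ℚ_ : ℚ → ℕ → ℚ
q ^ℚ zero = ℚ.1ℚ
q ^ℚ suc n = q ℚ.* (q ^ℚ n)

pow5 : ℤ → ℚ
pow5 (+ n) = (((+ 5) ℚ./ 1)) ^ℚ n
pow5 -[1+ n ] = (ℚ.1ℚ ℚ.÷ ((+ 5) ℚ./ 1)) ^ℚ suc n

toℚ : ℤ → ℚ
toℚ z = z ℚ./ 1

{-# OPTIONS --safe #-}
-- In ℤ[φ] = ℤ[x]/(x² - x - 1), with ψ = 1 - φ and √5 = φ - ψ, both sequences satisfy a Binet
-- formula √5^w G_x = φ^x + ε ψ^x, with (ε, w) = (-1, 1) for F and (1, 0) for L.  Expanding
-- (φ^x + ε ψ^x)^(2m+1) binomially and pairing the terms k and 2m+1-k gives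
-- Σ_i C(2m+1,i) (ε (-1)^x)^i (φ^(cx) + ε ψ^(cx)) with c = 2m+1-2i, and on x = j(2rk+s) the
-- sign no longer depends on k.  Summing against C(n,k) leaves the binomial sums
-- Σ_k C(n,k) φ^(2ak+b) = φ^(an+b) (φ^a + φ^(-a))^n, where φ^a + φ^(-a) = φ^a + (-1)^a ψ^a
-- is L_a or √5 F_a according to the parity of a = c·jr (likewise for ψ, with an extra sign
-- (-1)^(an)).  Back in ℤ both sides carry powers of √5 of equal parity, whose quotient is the
-- stated power of 5.
module Submission where

open import Defs
open import Data.Nat as ℕ using (ℕ; zero; suc; _∸_)
open import Data.Nat.Divisibility as ℕD using (divides)
open import Data.Integer as ℤ using (ℤ; +_; -[1+_]; _⊖_; 0ℤ; 1ℤ; -1ℤ)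
open import Data.Integer.Divisibility as ℤD using ()
open import Data.Rational as ℚ using (ℚ)
open import Data.Product using (_×_; _,_; proj₁; ∃)
open import Relation.Nullary using (¬_; contradiction)
open import Relation.Binary.PropositionalEquality

open import Algebra.Bundles using (CommutativeRing)
open import Algebra.Structures using (IsCommutativeRing)
import Data.Integer.Properties as ℤP
open import Data.Integer.Tactic.RingSolver as ℤSolver using ()
open import Data.Fin using (toℕ)
open import Data.Fin.Properties using (toℕ<n)
open import Data.List using (_∷_; []; foldr; map; applyUpTo)
open import Data.Maybe using (nothing)
import Data.Nat.Properties as ℕP
open import Data.Nat.Combinatorics using (_C_; nCk≡nC[n∸k])
open import Data.Nat.DivMod using (m*n/n≡m)
open import Data.Nat.Tactic.RingSolver as ℕSolver using ()
import Data.Rational.Properties as ℚP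
import Data.Rational.Unnormalised as ℚᵘ
import Data.Rational.Unnormalised.Properties as ℚᵘP
open import Data.Sum using (_⊎_; inj₁; inj₂)
open import Function using (_∘_; id)
open import Level using (0ℓ)
open import Tactic.RingSolver using (solve-∀)
import Tactic.RingSolver.Core.AlmostCommutativeRing as ACR
open ≡-Reasoning

-- The ring ℤ[φ]

infix  9 _+_·φ
infixl 6 _+_ _-_
infixl 7 _*_
infix  8 -_

data ℤ[φ] : Set where
  _+_·φ : ℤ → ℤ → ℤ[φ]

_+_ : ℤ[φ] → ℤ[φ] → ℤ[φ]
(a + b ·φ) + (c + d ·φ) = (a ℤ.+ c) + (b ℤ.+ d) ·φ

-- φ² = φ + 1
_*_ : ℤ[φ] → ℤ[φ] → ℤ[φ]
(a + b ·φ) * (c + d ·φ) = (a ℤ.* c ℤ.+ b ℤ.* d) + (a ℤ.* d ℤ.+ b ℤ.* c ℤ.+ b ℤ.* d) ·φ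

-_ : ℤ[φ] → ℤ[φ]
- (a + b ·φ) = (ℤ.- a) + (ℤ.- b) ·φ

_-_ : ℤ[φ] → ℤ[φ] → ℤ[φ]
x - y = x + - y

0# 1# : ℤ[φ]
0# = 0ℤ + 0ℤ ·φ
1# = 1ℤ + 0ℤ ·φ

ℤ[φ]-isCommutativeRing : IsCommutativeRing _≡_ _+_ _*_ -_ 0# 1#
ℤ[φ]-isCommutativeRing = record
  { isRing = record
    { +-isAbelianGroup = record
      { isGroup = record
        { isMonoid = record
          { isSemigroup = record
            { isMagma = record { isEquivalence = isEquivalence ; ∙-cong = cong₂ _+_ }
            ; assoc = +-assoc }
          ; identity = +-identityˡ , +-identityʳ }
        ; inverse = -‿inverseˡ , -‿inverseʳ
        ; ⁻¹-cong = cong (-_) }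
      ; comm = +-comm }
    ; *-cong = cong₂ _*_
    ; *-assoc = *-assoc
    ; *-identity = *-identityˡ , *-identityʳ
    ; distrib = *-distribˡ-+ , *-distribʳ-+
    }
  ; *-comm = *-comm
  }
  where
  +-assoc : ∀ x y z → (x + y) + z ≡ x + (y + z)
  +-assoc (a + b ·φ) (c + d ·φ) (e + f ·φ) = cong₂ _+_·φ (ℤP.+-assoc a c e) (ℤP.+-assoc b d f)
  +-comm : ∀ x y → x + y ≡ y + x
  +-comm (a + b ·φ) (c + d ·φ) = cong₂ _+_·φ (ℤP.+-comm a c) (ℤP.+-comm b d)
  +-identityˡ : ∀ x → 0# + x ≡ x
  +-identityˡ (a + b ·φ) = cong₂ _+_·φ (ℤP.+-identityˡ a) (ℤP.+-identityˡ b)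
  +-identityʳ : ∀ x → x + 0# ≡ x
  +-identityʳ (a + b ·φ) = cong₂ _+_·φ (ℤP.+-identityʳ a) (ℤP.+-identityʳ b)
  -‿inverseˡ : ∀ x → - x + x ≡ 0#
  -‿inverseˡ (a + b ·φ) = cong₂ _+_·φ (ℤP.+-inverseˡ a) (ℤP.+-inverseˡ b)
  -‿inverseʳ : ∀ x → x + - x ≡ 0#
  -‿inverseʳ (a + b ·φ) = cong₂ _+_·φ (ℤP.+-inverseʳ a) (ℤP.+-inverseʳ b)
  *-assoc : ∀ x y z → (x * y) * z ≡ x * (y * z)
  *-assoc (a + b ·φ) (c + d ·φ) (e + f ·φ) =
    cong₂ _+_·φ (ℤSolver.solve (a ∷ b ∷ c ∷ d ∷ e ∷ f ∷ [])) (ℤSolver.solve (a ∷ b ∷ c ∷ d ∷ e ∷ f ∷ []))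
  *-comm : ∀ x y → x * y ≡ y * x
  *-comm (a + b ·φ) (c + d ·φ) = cong₂ _+_·φ (ℤSolver.solve (a ∷ b ∷ c ∷ d ∷ [])) (ℤSolver.solve (a ∷ b ∷ c ∷ d ∷ []))
  *-identityˡ : ∀ x → 1# * x ≡ x
  *-identityˡ (a + b ·φ) = cong₂ _+_·φ (ℤSolver.solve (a ∷ b ∷ [])) (ℤSolver.solve (a ∷ b ∷ []))
  *-identityʳ : ∀ x → x * 1# ≡ x
  *-identityʳ (a + b ·φ) = cong₂ _+_·φ (ℤSolver.solve (a ∷ b ∷ [])) (ℤSolver.solve (a ∷ b ∷ []))
  *-distribˡ-+ : ∀ x y z → x * (y + z) ≡ x * y + x * z
  *-distribˡ-+ (a + b ·φ) (c + d ·φ) (e + f ·φ) =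
    cong₂ _+_·φ (ℤSolver.solve (a ∷ b ∷ c ∷ d ∷ e ∷ f ∷ [])) (ℤSolver.solve (a ∷ b ∷ c ∷ d ∷ e ∷ f ∷ []))
  *-distribʳ-+ : ∀ x y z → (y + z) * x ≡ y * x + z * x
  *-distribʳ-+ (a + b ·φ) (c + d ·φ) (e + f ·φ) =
    cong₂ _+_·φ (ℤSolver.solve (a ∷ b ∷ c ∷ d ∷ e ∷ f ∷ [])) (ℤSolver.solve (a ∷ b ∷ c ∷ d ∷ e ∷ f ∷ []))

ℤ[φ]-commutativeRing : CommutativeRing 0ℓ 0ℓ
ℤ[φ]-commutativeRing = record { isCommutativeRing = ℤ[φ]-isCommutativeRing }

open CommutativeRing ℤ[φ]-commutativeRing
  using (*-commutativeSemigroup; +-assoc; +-comm; +-identityˡ; +-identityʳ; *-assoc; *-comm; *-identityˡ; *-identityʳ;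
         distribˡ; distribʳ; zeroˡ; semiring; commutativeSemiring)

ℤ[φ]-ring : ACR.AlmostCommutativeRing 0ℓ 0ℓ
ℤ[φ]-ring = ACR.fromCommutativeRing ℤ[φ]-commutativeRing (λ _ → nothing)

open import Algebra.Properties.CommutativeSemiring.Exp commutativeSemiring
  using (_^_; ^-homo-*; ^-assocʳ; ^-distrib-*)
open import Algebra.Properties.CommutativeSemigroup *-commutativeSemigroup
  using (x∙yz≈y∙xz; x∙yz≈yx∙z; xy∙z≈xz∙y) renaming (interchange to *-interchange)
open import Algebra.Properties.Semiring.Sum semiring
  using (sum; sum-cong-≗; ∑-comm; ∑-distrib-+; *-distribˡ-sum; *-distribʳ-sum)
open import Algebra.Properties.Semiring.Mult semiring using () renaming (_×_ to _×ᵣ_)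
import Algebra.Properties.CommutativeSemiring.Binomial commutativeSemiring as Binomial

infix 9 φ^_ ψ^_ -1^_

ι : ℤ → ℤ[φ]
ι z = z + 0ℤ ·φ

rational-part : ℤ[φ] → ℤ
rational-part (a + _ ·φ) = a

ι-injective : ∀ {a b} → ι a ≡ ι b → a ≡ b
ι-injective = cong rational-part

ι-* : ∀ a b → ι (a ℤ.* b) ≡ ι a * ι b
ι-* a b = cong₂ _+_·φ (ℤSolver.solve (a ∷ b ∷ [])) (ℤSolver.solve (a ∷ b ∷ []))

ι-^ : ∀ a n → ι (a ℤ.^ n) ≡ ι a ^ n
ι-^ a zero = refl
ι-^ a (suc n) = trans (ι-* a (a ℤ.^ n)) (cong (ι a *_) (ι-^ a n))

φ ψ √5 : ℤ[φ]
φ = 0ℤ + 1ℤ ·φ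
ψ = 1ℤ + -1ℤ ·φ
√5 = -1ℤ + (+ 2) ·φ

1#^ : ∀ n → 1# ^ n ≡ 1#
1#^ zero = refl
1#^ (suc n) = trans (*-identityˡ _) (1#^ n)

involution-^-odd : ∀ {σ} → σ * σ ≡ 1# → ∀ t → σ ^ (2 ℕ.* t ℕ.+ 1) ≡ σ
involution-^-odd {σ} σ²≡1 t = begin
  σ ^ (2 ℕ.* t ℕ.+ 1)    ≡⟨ ^-homo-* σ (2 ℕ.* t) 1 ⟩
  σ ^ (2 ℕ.* t) * σ ^ 1  ≡⟨ cong₂ _*_ (sym (^-assocʳ σ 2 t)) (*-identityʳ σ) ⟩
  (σ ^ 2) ^ t * σ        ≡⟨ cong (λ y → y ^ t * σ) (trans (cong (σ *_) (*-identityʳ σ)) σ²≡1) ⟩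
  1# ^ t * σ             ≡⟨ cong (_* σ) (1#^ t) ⟩
  1# * σ                 ≡⟨ *-identityˡ σ ⟩
  σ                      ∎

-- Integer powers of units

zpow : ℤ[φ] → ℤ[φ] → ℤ → ℤ[φ]
zpow u u⁻¹ (+ n) = u ^ n
zpow u u⁻¹ -[1+ n ] = u⁻¹ ^ suc n

module _ {u u⁻¹ : ℤ[φ]} (inverse : u * u⁻¹ ≡ 1#) where

  zpow-⊖ : ∀ p q → zpow u u⁻¹ (p ⊖ q) ≡ u ^ p * u⁻¹ ^ q
  zpow-⊖ zero zero = sym (*-identityˡ 1#)
  zpow-⊖ (suc p) zero = sym (*-identityʳ _)
  zpow-⊖ zero (suc q) = sym (*-identityˡ _)
  zpow-⊖ (suc p) (suc q) = begin
    zpow u u⁻¹ (suc p ⊖ suc q)        ≡⟨ cong (zpow u u⁻¹) (ℤP.[1+m]⊖[1+n]≡m⊖n p q) ⟩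
    zpow u u⁻¹ (p ⊖ q)                ≡⟨ zpow-⊖ p q ⟩
    u ^ p * u⁻¹ ^ q                   ≡⟨ sym (*-identityˡ _) ⟩
    1# * (u ^ p * u⁻¹ ^ q)            ≡⟨ cong (_* (u ^ p * u⁻¹ ^ q)) (sym inverse) ⟩
    u * u⁻¹ * (u ^ p * u⁻¹ ^ q)       ≡⟨ *-interchange u u⁻¹ (u ^ p) (u⁻¹ ^ q) ⟩
    u * u ^ p * (u⁻¹ * u⁻¹ ^ q)       ∎

  zpow-+ : ∀ x y → zpow u u⁻¹ (x ℤ.+ y) ≡ zpow u u⁻¹ x * zpow u u⁻¹ y
  zpow-+ (+ a) (+ b) = ^-homo-* u a b
  zpow-+ (+ a) -[1+ b ] = zpow-⊖ a (suc b)
  zpow-+ -[1+ a ] (+ b) = trans (zpow-⊖ b (suc a)) (*-comm _ _)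
  zpow-+ -[1+ a ] -[1+ b ] =
    trans (cong (λ k → u⁻¹ ^ suc k) (sym (ℕP.+-suc a b))) (^-homo-* u⁻¹ (suc a) (suc b))

  zpow-*ℕ : ∀ c x → zpow u u⁻¹ (+ c ℤ.* x) ≡ zpow u u⁻¹ x ^ c
  zpow-*ℕ zero x = cong (zpow u u⁻¹) (ℤP.*-zeroˡ x)
  zpow-*ℕ (suc c) x = begin
    zpow u u⁻¹ (+ suc c ℤ.* x)             ≡⟨ cong (zpow u u⁻¹) (ℤP.suc-* (+ c) x) ⟩
    zpow u u⁻¹ (x ℤ.+ + c ℤ.* x)           ≡⟨ zpow-+ x (+ c ℤ.* x) ⟩
    zpow u u⁻¹ x * zpow u u⁻¹ (+ c ℤ.* x)  ≡⟨ cong (zpow u u⁻¹ x *_) (zpow-*ℕ c x) ⟩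
    zpow u u⁻¹ x * zpow u u⁻¹ x ^ c        ∎

zpow-neg : ∀ u u⁻¹ x → zpow u u⁻¹ (ℤ.- x) ≡ zpow u⁻¹ u x
zpow-neg u u⁻¹ (+ zero) = refl
zpow-neg u u⁻¹ (+ suc n) = refl
zpow-neg u u⁻¹ -[1+ n ] = refl

zpow-distrib-* : ∀ u u⁻¹ v v⁻¹ x → zpow (u * v) (u⁻¹ * v⁻¹) x ≡ zpow u u⁻¹ x * zpow v v⁻¹ x
zpow-distrib-* u u⁻¹ v v⁻¹ (+ n) = ^-distrib-* u v n
zpow-distrib-* u u⁻¹ v v⁻¹ -[1+ n ] = ^-distrib-* u⁻¹ v⁻¹ (suc n)

φ^_ ψ^_ -1^_ : ℤ → ℤ[φ]
φ^_ = zpow φ (φ - 1#)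
ψ^_ = zpow ψ (- φ)
-1^_ = zpow (- 1#) (- 1#)

-1^-+ : ∀ x y → -1^ (x ℤ.+ y) ≡ -1^ x * -1^ y
-1^-+ = zpow-+ refl

φ^-*ℕ : ∀ c x → φ^ (+ c ℤ.* x) ≡ (φ^ x) ^ c
φ^-*ℕ = zpow-*ℕ refl

ψ^-*ℕ : ∀ c x → ψ^ (+ c ℤ.* x) ≡ (ψ^ x) ^ c
ψ^-*ℕ = zpow-*ℕ refl

-1^-*ℕ : ∀ c x → -1^ (+ c ℤ.* x) ≡ (-1^ x) ^ c
-1^-*ℕ = zpow-*ℕ refl

-- φ⁻¹ = φ - 1 = -ψ and ψ⁻¹ = -φ hold by computation.
φ^-neg : ∀ x → φ^ (ℤ.- x) ≡ -1^ x * ψ^ x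
φ^-neg x = trans (zpow-neg φ (φ - 1#) x) (zpow-distrib-* (- 1#) (- 1#) ψ (- φ) x)

ψ^-neg : ∀ x → ψ^ (ℤ.- x) ≡ -1^ x * φ^ x
ψ^-neg x = trans (zpow-neg ψ (- φ) x) (zpow-distrib-* (- 1#) (- 1#) φ (φ - 1#) x)

φ^*ψ^ : ∀ x → φ^ x * ψ^ x ≡ -1^ x
φ^*ψ^ x = sym (zpow-distrib-* φ (φ - 1#) ψ (- φ) x)

-1^-involutive : ∀ x → -1^ x * -1^ x ≡ 1#
-1^-involutive x = trans (sym (zpow-distrib-* (- 1#) (- 1#) (- 1#) (- 1#) x)) (1#-zpow x)
  where
  1#-zpow : ∀ x → zpow 1# 1# x ≡ 1#
  1#-zpow (+ n) = 1#^ n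
  1#-zpow -[1+ n ] = 1#^ (suc n)

ι-neg1^ : ∀ e → ι (neg1^ e) ≡ -1^ e
ι-neg1^ (+ n) = ι-^ -1ℤ n
ι-neg1^ -[1+ n ] = ι-^ -1ℤ (suc n)

-- Binet sequences

binet : ℤ[φ] → ℤ → ℤ[φ]
binet ε x = φ^ x + ε * ψ^ x

binet-step : ∀ ε n → binet ε (+ suc n) + binet ε (+ n) ≡ binet ε (+ suc (suc n))
binet-step ε n = begin
  (φ * a + ε * (ψ * b)) + (a + ε * b)       ≡⟨ regroup ε φ ψ a b ⟩
  (φ * a + a) + ε * (ψ * b + b)             ≡⟨ cong₂ (λ p q → p + ε * q) (golden φ a refl) (golden ψ b refl) ⟩
  φ * (φ * a) + ε * (ψ * (ψ * b))           ∎
  where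
  a = φ^ (+ n)
  b = ψ^ (+ n)
  regroup : ∀ ε φ ψ a b → (φ * a + ε * (ψ * b)) + (a + ε * b) ≡ (φ * a + a) + ε * (ψ * b + b)
  regroup = solve-∀ ℤ[φ]-ring
  golden : ∀ t A → t * t ≡ t + 1# → t * A + A ≡ t * (t * A)
  golden t A t²≡t+1 = begin
    t * A + A         ≡⟨ cong (_+_ (t * A)) (sym (*-identityˡ A)) ⟩
    t * A + 1# * A    ≡⟨ sym (distribʳ A t 1#) ⟩
    (t + 1#) * A      ≡⟨ cong (_* A) (sym t²≡t+1) ⟩
    t * t * A         ≡⟨ *-assoc t t A ⟩
    t * (t * A)       ∎

binet-ℕ : (g : ℕ → ℕ) (ε ρ : ℤ[φ]) → (∀ n → g (suc (suc n)) ≡ g (suc n) ℕ.+ g n) →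
  ι (+ g 0) * ρ ≡ binet ε (+ 0) → ι (+ g 1) * ρ ≡ binet ε (+ 1) →
  ∀ n → ι (+ g n) * ρ ≡ binet ε (+ n)
binet-ℕ g ε ρ recurrence g₀ g₁ n = proj₁ (consecutive n)
  where
  consecutive : ∀ n → ι (+ g n) * ρ ≡ binet ε (+ n) × ι (+ g (suc n)) * ρ ≡ binet ε (+ suc n)
  consecutive zero = g₀ , g₁
  consecutive (suc n) with consecutive n
  ... | gₙ , gₙ₊₁ = gₙ₊₁ , (begin
    ι (+ g (suc (suc n))) * ρ                   ≡⟨ cong (λ k → ι (+ k) * ρ) (recurrence n) ⟩
    (ι (+ g (suc n)) + ι (+ g n)) * ρ           ≡⟨ distribʳ ρ _ _ ⟩
    ι (+ g (suc n)) * ρ + ι (+ g n) * ρ         ≡⟨ cong₂ _+_ gₙ₊₁ gₙ ⟩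
    binet ε (+ suc n) + binet ε (+ n)           ≡⟨ binet-step ε n ⟩
    binet ε (+ suc (suc n))                     ∎)

swap-sign : ∀ {σ} → σ * σ ≡ 1# → ∀ a b → b + σ * a ≡ σ * (a + σ * b)
swap-sign {σ} σ²≡1 a b = begin
  b + σ * a              ≡⟨ cong (λ y → y + σ * a) (sym (trans (cong (_* b) σ²≡1) (*-identityˡ b))) ⟩
  σ * σ * b + σ * a      ≡⟨ factor σ a b ⟩
  σ * (a + σ * b)        ∎
  where
  factor : ∀ σ a b → σ * σ * b + σ * a ≡ σ * (a + σ * b)
  factor = solve-∀ ℤ[φ]-ring

binet-neg : ∀ {ε} → ε * ε ≡ 1# → ∀ x → binet ε (ℤ.- x) ≡ ε * -1^ x * binet ε x
binet-neg {ε} ε²≡1 x = begin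
  φ^ (ℤ.- x) + ε * ψ^ (ℤ.- x)            ≡⟨ cong₂ (λ p q → p + ε * q) (φ^-neg x) (ψ^-neg x) ⟩
  -1^ x * ψ^ x + ε * (-1^ x * φ^ x)      ≡⟨ cong (_+_ (-1^ x * ψ^ x)) (x∙yz≈y∙xz ε (-1^ x) (φ^ x)) ⟩
  -1^ x * ψ^ x + -1^ x * (ε * φ^ x)      ≡⟨ sym (distribˡ (-1^ x) (ψ^ x) (ε * φ^ x)) ⟩
  -1^ x * (ψ^ x + ε * φ^ x)              ≡⟨ cong (-1^ x *_) (swap-sign ε²≡1 (φ^ x) (ψ^ x)) ⟩
  -1^ x * (ε * binet ε x)                ≡⟨ x∙yz≈yx∙z (-1^ x) ε (binet ε x) ⟩
  ε * -1^ x * binet ε x                  ∎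

binet-ℤ : ∀ {ε ρ} (G : ℤ → ℤ) → ε * ε ≡ 1# → (∀ n → ι (G (+ n)) * ρ ≡ binet ε (+ n)) →
  (∀ n → ι (G -[1+ n ]) ≡ ε * -1^ (+ suc n) * ι (G (+ suc n))) → ∀ x → ι (G x) * ρ ≡ binet ε x
binet-ℤ G ε²≡1 nonnegative reflect (+ n) = nonnegative n
binet-ℤ {ε} {ρ} G ε²≡1 nonnegative reflect -[1+ n ] = begin
  ι (G -[1+ n ]) * ρ                           ≡⟨ cong (_* ρ) (reflect n) ⟩
  ε * -1^ (+ suc n) * ι (G (+ suc n)) * ρ      ≡⟨ *-assoc (ε * -1^ (+ suc n)) (ι (G (+ suc n))) ρ ⟩
  ε * -1^ (+ suc n) * (ι (G (+ suc n)) * ρ)    ≡⟨ cong (_*_ (ε * -1^ (+ suc n))) (nonnegative (suc n)) ⟩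
  ε * -1^ (+ suc n) * binet ε (+ suc n)        ≡⟨ sym (binet-neg ε²≡1 (+ suc n)) ⟩
  binet ε -[1+ n ]                             ∎

record BinetSequence : Set where
  field
    seq     : ℤ → ℤ
    sign    : ℤ[φ]
    sign²   : sign * sign ≡ 1#
    weight  : ℕ
    formula : ∀ x → ι (seq x) * √5 ^ weight ≡ binet sign x

fibonacci : BinetSequence
fibonacci = record
  { seq = F ; sign = - 1# ; sign² = refl ; weight = 1
  ; formula = binet-ℤ F refl (binet-ℕ fibℕ (- 1#) (√5 ^ 1) (λ _ → refl) refl refl) reflect
  }
  where
  sign-twice : ∀ y → - 1# * (- 1# * y) ≡ y
  sign-twice = solve-∀ ℤ[φ]-ring
  reflect : ∀ n → ι (F -[1+ n ]) ≡ - 1# * -1^ (+ suc n) * ι (F (+ suc n))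
  reflect n = trans (ι-* (-1ℤ ℤ.^ n) (+ fibℕ (suc n)))
                    (cong (_* ι (+ fibℕ (suc n))) (trans (ι-^ -1ℤ n) (sym (sign-twice ((- 1#) ^ n)))))

lucas : BinetSequence
lucas = record
  { seq = L ; sign = 1# ; sign² = refl ; weight = 0
  ; formula = binet-ℤ L refl (binet-ℕ lucℕ 1# 1# (λ _ → refl) refl refl) reflect
  }
  where
  reflect : ∀ n → ι (L -[1+ n ]) ≡ 1# * -1^ (+ suc n) * ι (L (+ suc n))
  reflect n = trans (ι-* (-1ℤ ℤ.^ suc n) (+ lucℕ (suc n)))
                    (cong (_* ι (+ lucℕ (suc n))) (trans (ι-^ -1ℤ (suc n)) (sym (*-identityˡ _))))

-- Finite sums and the binomial theorem

∑< : ℕ → (ℕ → ℤ[φ]) → ℤ[φ]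
∑< n f = sum {n} (f ∘ toℕ)

∑<-cong : ∀ n {f g : ℕ → ℤ[φ]} → (∀ k → k ℕ.< n → f k ≡ g k) → ∑< n f ≡ ∑< n g
∑<-cong n f≗g = sum-cong-≗ (λ k → f≗g (toℕ k) (toℕ<n k))

∑<-distribˡ : ∀ n x f → x * ∑< n f ≡ ∑< n (λ k → x * f k)
∑<-distribˡ n x f = *-distribˡ-sum {n} x (f ∘ toℕ)

∑<-distribʳ : ∀ n x f → ∑< n f * x ≡ ∑< n (λ k → f k * x)
∑<-distribʳ n x f = *-distribʳ-sum {n} x (f ∘ toℕ)

∑<-+ : ∀ n f g → ∑< n (λ k → f k + g k) ≡ ∑< n f + ∑< n g
∑<-+ n f g = ∑-distrib-+ {n} (f ∘ toℕ) (g ∘ toℕ)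

∑<-comm : ∀ m n (f : ℕ → ℕ → ℤ[φ]) → ∑< m (λ i → ∑< n (f i)) ≡ ∑< n (λ k → ∑< m (λ i → f i k))
∑<-comm m n f = ∑-comm {m} {n} (λ i k → f (toℕ i) (toℕ k))

∑<-split : ∀ a b f → ∑< (a ℕ.+ b) f ≡ ∑< a f + ∑< b (λ k → f (a ℕ.+ k))
∑<-split zero b f = sym (+-identityˡ _)
∑<-split (suc a) b f = trans (cong (_+_ (f 0)) (∑<-split a b (f ∘ suc))) (sym (+-assoc _ _ _))

∑<-snoc : ∀ n f → ∑< (suc n) f ≡ ∑< n f + f n
∑<-snoc zero f = trans (+-identityʳ (f 0)) (sym (+-identityˡ (f 0)))
∑<-snoc (suc n) f = trans (cong (_+_ (f 0)) (∑<-snoc n (f ∘ suc))) (sym (+-assoc _ _ _))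

∑<-reverse : ∀ n f → ∑< n f ≡ ∑< n (λ k → f (n ∸ suc k))
∑<-reverse zero f = refl
∑<-reverse (suc n) f = begin
  ∑< (suc n) f                           ≡⟨ ∑<-snoc n f ⟩
  ∑< n f + f n                           ≡⟨ cong (_+ f n) (∑<-reverse n f) ⟩
  ∑< n (λ k → f (n ∸ suc k)) + f n       ≡⟨ +-comm _ _ ⟩
  f n + ∑< n (λ k → f (n ∸ suc k))       ∎

∑<-pair-ends : ∀ m f → ∑< (suc (2 ℕ.* m ℕ.+ 1)) f ≡ ∑< (suc m) (λ i → f i + f (2 ℕ.* m ℕ.+ 1 ∸ i))
∑<-pair-ends m f = begin
  ∑< (suc N) f
    ≡⟨ cong (λ k → ∑< k f) (halves m) ⟩
  ∑< (suc m ℕ.+ suc m) f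
    ≡⟨ ∑<-split (suc m) (suc m) f ⟩
  ∑< (suc m) f + ∑< (suc m) (λ k → f (suc m ℕ.+ k))
    ≡⟨ cong (_+_ (∑< (suc m) f)) (∑<-reverse (suc m) (λ k → f (suc m ℕ.+ k))) ⟩
  ∑< (suc m) f + ∑< (suc m) (λ i → f (suc m ℕ.+ (m ∸ i)))
    ≡⟨ sym (∑<-+ (suc m) f (λ i → f (suc m ℕ.+ (m ∸ i)))) ⟩
  ∑< (suc m) (λ i → f i + f (suc m ℕ.+ (m ∸ i)))
    ≡⟨ ∑<-cong (suc m) (λ i i<1+m → cong (λ k → f i + f k) (mirror (ℕP.m<1+n⇒m≤n i<1+m))) ⟩
  ∑< (suc m) (λ i → f i + f (N ∸ i)) ∎
  where
  N = 2 ℕ.* m ℕ.+ 1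
  halves : ∀ m → suc (2 ℕ.* m ℕ.+ 1) ≡ suc m ℕ.+ suc m
  halves = ℕSolver.solve-∀
  N≡1+m+m : ∀ m → 2 ℕ.* m ℕ.+ 1 ≡ suc m ℕ.+ m
  N≡1+m+m = ℕSolver.solve-∀
  mirror : ∀ {i} → i ℕ.≤ m → suc m ℕ.+ (m ∸ i) ≡ N ∸ i
  mirror {i} i≤m = sym (trans (cong (_∸ i) (N≡1+m+m m)) (ℕP.+-∸-assoc (suc m) i≤m))

ι-sumTo : ∀ n f → ι (sumTo n f) ≡ ∑< (suc n) (ι ∘ f)
ι-sumTo n f = go (suc n) (λ k → k)
  where
  go : ∀ c g → ι (foldr ℤ._+_ (+ 0) (map f (applyUpTo g c))) ≡ ∑< c (λ k → ι (f (g k)))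
  go zero g = refl
  go (suc c) g = cong (_+_ (ι (f (g 0)))) (go c (g ∘ suc))

×-as-ι : ∀ c x → c ×ᵣ x ≡ ι (+ c) * x
×-as-ι zero x = sym (zeroˡ x)
×-as-ι (suc c) x = begin
  x + c ×ᵣ x            ≡⟨ cong₂ _+_ (sym (*-identityˡ x)) (×-as-ι c x) ⟩
  1# * x + ι (+ c) * x  ≡⟨ sym (distribʳ x 1# (ι (+ c))) ⟩
  ι (+ suc c) * x       ∎

binomial : ∀ n x y → (x + y) ^ n ≡ ∑< (suc n) (λ k → ι (binom n k) * (x ^ k * y ^ (n ∸ k)))
binomial n x y = trans (Binomial.theorem n x y) (∑<-cong (suc n) (λ k _ → ×-as-ι (n C k) (x ^ k * y ^ (n ∸ k))))

ι-sumTo-*ʳ : ∀ n f ρ → ι (sumTo n f) * ρ ≡ ∑< (suc n) (λ k → ι (f k) * ρ)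
ι-sumTo-*ʳ n f ρ = trans (cong (_* ρ) (ι-sumTo n f)) (∑<-distribʳ (suc n) ρ (ι ∘ f))

odd-∸ : ∀ {i m} → i ℕ.≤ m → 2 ℕ.* m ℕ.+ 1 ∸ i ≡ i ℕ.+ (2 ℕ.* (m ∸ i) ℕ.+ 1)
odd-∸ {i} {m} i≤m = begin
  2 ℕ.* m ℕ.+ 1 ∸ i                   ≡⟨ cong (λ k → 2 ℕ.* k ℕ.+ 1 ∸ i) (sym (ℕP.m+[n∸m]≡n i≤m)) ⟩
  2 ℕ.* (i ℕ.+ t) ℕ.+ 1 ∸ i           ≡⟨ cong (_∸ i) (regroup i t) ⟩
  i ℕ.+ (2 ℕ.* t ℕ.+ 1) ℕ.+ i ∸ i     ≡⟨ ℕP.m+n∸n≡m _ i ⟩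
  i ℕ.+ (2 ℕ.* t ℕ.+ 1)               ∎
  where
  t = m ∸ i
  regroup : ∀ i t → 2 ℕ.* (i ℕ.+ t) ℕ.+ 1 ≡ i ℕ.+ (2 ℕ.* t ℕ.+ 1) ℕ.+ i
  regroup = ℕSolver.solve-∀

≤-odd : ∀ {i m} → i ℕ.≤ m → i ℕ.≤ 2 ℕ.* m ℕ.+ 1
≤-odd {i} {m} i≤m = ℕP.≤-trans i≤m (ℕP.≤-trans (ℕP.m≤n*m m 2) (ℕP.m≤m+n (2 ℕ.* m) 1))

odd-binomial : ∀ m x y → (x + y) ^ (2 ℕ.* m ℕ.+ 1) ≡
  ∑< (suc m) (λ i → ι (binom (2 ℕ.* m ℕ.+ 1) i) *
                    ((x * y) ^ i * (x ^ (2 ℕ.* (m ∸ i) ℕ.+ 1) + y ^ (2 ℕ.* (m ∸ i) ℕ.+ 1))))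
odd-binomial m x y = begin
  (x + y) ^ N                                ≡⟨ binomial N x y ⟩
  ∑< (suc N) term                            ≡⟨ ∑<-pair-ends m term ⟩
  ∑< (suc m) (λ i → term i + term (N ∸ i))   ≡⟨ ∑<-cong (suc m) (λ i i<1+m → paired (ℕP.m<1+n⇒m≤n i<1+m)) ⟩
  _                                          ∎
  where
  N = 2 ℕ.* m ℕ.+ 1
  term : ℕ → ℤ[φ]
  term k = ι (binom N k) * (x ^ k * y ^ (N ∸ k))
  collect : ∀ c a b d e → c * (a * (b * d)) + c * ((a * e) * b) ≡ c * ((a * b) * (e + d))
  collect = solve-∀ ℤ[φ]-ring
  paired : ∀ {i} → i ℕ.≤ m → term i + term (N ∸ i) ≡
    ι (binom N i) * ((x * y) ^ i * (x ^ (2 ℕ.* (m ∸ i) ℕ.+ 1) + y ^ (2 ℕ.* (m ∸ i) ℕ.+ 1)))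
  paired {i} i≤m = begin
    term i + term (N ∸ i)
      ≡⟨ cong₂ _+_ (cong (λ k → c * (x ^ i * y ^ k)) (odd-∸ i≤m))
                   (cong₂ _*_ (cong (ι ∘ +_) (sym (nCk≡nC[n∸k] (≤-odd i≤m))))
                              (cong₂ (λ a b → x ^ a * y ^ b) (odd-∸ i≤m) (ℕP.m∸[m∸n]≡n (≤-odd i≤m)))) ⟩
    c * (x ^ i * y ^ (i ℕ.+ D)) + c * (x ^ (i ℕ.+ D) * y ^ i)
      ≡⟨ cong₂ (λ p q → c * (x ^ i * p) + c * (q * y ^ i)) (^-homo-* y i D) (^-homo-* x i D) ⟩
    c * (x ^ i * (y ^ i * y ^ D)) + c * ((x ^ i * x ^ D) * y ^ i)
      ≡⟨ collect c (x ^ i) (y ^ i) (y ^ D) (x ^ D) ⟩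
    c * ((x ^ i * y ^ i) * (x ^ D + y ^ D))
      ≡⟨ cong (λ p → c * (p * (x ^ D + y ^ D))) (sym (^-distrib-* x y i)) ⟩
    c * ((x * y) ^ i * (x ^ D + y ^ D))     ∎
    where
    c = ι (binom N i)
    D = 2 ℕ.* (m ∸ i) ℕ.+ 1

-- Binomial sums of Binet sequences

odd-coefficient : ℕ → ℕ → ℤ
odd-coefficient m i = + (2 ℕ.* m ℕ.+ 1) ℤ.- + 2 ℤ.* + i

odd-coefficient≡ : ∀ {i m} → i ℕ.≤ m → odd-coefficient m i ≡ + (2 ℕ.* (m ∸ i) ℕ.+ 1)
odd-coefficient≡ {i} {m} i≤m = begin
  + N ℤ.- + 2 ℤ.* + i                    ≡⟨ cong (λ k → + k ℤ.- + 2 ℤ.* + i) (sym (ℕP.m+[n∸m]≡n (≤-odd i≤m))) ⟩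
  + (i ℕ.+ (N ∸ i)) ℤ.- + 2 ℤ.* + i      ≡⟨ cong (λ k → + (i ℕ.+ k) ℤ.- + 2 ℤ.* + i) (odd-∸ i≤m) ⟩
  + (i ℕ.+ (i ℕ.+ D)) ℤ.- + 2 ℤ.* + i    ≡⟨ cong (ℤ._- + 2 ℤ.* + i)
                                              (trans (ℤP.pos-+ i (i ℕ.+ D)) (cong (ℤ._+_ (+ i)) (ℤP.pos-+ i D))) ⟩
  + i ℤ.+ (+ i ℤ.+ + D) ℤ.- + 2 ℤ.* + i  ≡⟨ cancel (+ i) (+ D) ⟩
  + D                                    ∎
  where
  N = 2 ℕ.* m ℕ.+ 1
  D = 2 ℕ.* (m ∸ i) ℕ.+ 1
  cancel : ∀ a d → a ℤ.+ (a ℤ.+ d) ℤ.- + 2 ℤ.* a ≡ d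
  cancel = ℤSolver.solve-∀

binet-odd-power : ∀ {ε} → ε * ε ≡ 1# → ∀ m x → binet ε x ^ (2 ℕ.* m ℕ.+ 1) ≡
  ∑< (suc m) (λ i → ι (binom (2 ℕ.* m ℕ.+ 1) i) * ((ε * -1^ x) ^ i * binet ε (odd-coefficient m i ℤ.* x)))
binet-odd-power {ε} ε²≡1 m x = begin
  binet ε x ^ (2 ℕ.* m ℕ.+ 1)
    ≡⟨ odd-binomial m (φ^ x) (ε * ψ^ x) ⟩
  ∑< (suc m) (λ i → ι (binom (2 ℕ.* m ℕ.+ 1) i) * ((φ^ x * (ε * ψ^ x)) ^ i * (φ^ x ^ D i + (ε * ψ^ x) ^ D i)))
    ≡⟨ ∑<-cong (suc m) (λ i i<1+m → cong₂ (λ p q → ι (binom (2 ℕ.* m ℕ.+ 1) i) * (p ^ i * q))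
                                          product (odd-powers (ℕP.m<1+n⇒m≤n i<1+m))) ⟩
  ∑< (suc m) (λ i → ι (binom (2 ℕ.* m ℕ.+ 1) i) * ((ε * -1^ x) ^ i * binet ε (odd-coefficient m i ℤ.* x))) ∎
  where
  D : ℕ → ℕ
  D i = 2 ℕ.* (m ∸ i) ℕ.+ 1
  product : φ^ x * (ε * ψ^ x) ≡ ε * -1^ x
  product = trans (x∙yz≈y∙xz (φ^ x) ε (ψ^ x)) (cong (ε *_) (φ^*ψ^ x))
  odd-powers : ∀ {i} → i ℕ.≤ m → φ^ x ^ D i + (ε * ψ^ x) ^ D i ≡ binet ε (odd-coefficient m i ℤ.* x)
  odd-powers {i} i≤m = begin
    φ^ x ^ D i + (ε * ψ^ x) ^ D i
      ≡⟨ cong (_+_ (φ^ x ^ D i))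
              (trans (^-distrib-* ε (ψ^ x) (D i)) (cong (_* ψ^ x ^ D i) (involution-^-odd ε²≡1 (m ∸ i)))) ⟩
    φ^ x ^ D i + ε * ψ^ x ^ D i
      ≡⟨ sym (cong₂ (λ p q → p + ε * q) (φ^-*ℕ (D i) x) (ψ^-*ℕ (D i) x)) ⟩
    binet ε (+ D i ℤ.* x)
      ≡⟨ cong (λ c → binet ε (c ℤ.* x)) (sym (odd-coefficient≡ i≤m)) ⟩
    binet ε (odd-coefficient m i ℤ.* x) ∎

module _ {u u⁻¹ : ℤ[φ]} (inverse : u * u⁻¹ ≡ 1#) where
  private
    U = zpow u u⁻¹

  zpow-double+1 : ∀ a → U (+ 2 ℤ.* a) + 1# ≡ U a * (U a + U (ℤ.- a))
  zpow-double+1 a = begin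
    U (+ 2 ℤ.* a) + 1#                 ≡⟨ cong₂ _+_ (zpow-*ℕ inverse 2 a) unit ⟩
    U a * (U a * 1#) + U a * U (ℤ.- a) ≡⟨ cong (λ y → U a * y + U a * U (ℤ.- a)) (*-identityʳ (U a)) ⟩
    U a * U a + U a * U (ℤ.- a)        ≡⟨ sym (distribˡ (U a) (U a) (U (ℤ.- a))) ⟩
    U a * (U a + U (ℤ.- a))            ∎
    where
    unit : 1# ≡ U a * U (ℤ.- a)
    unit = sym (trans (sym (zpow-+ inverse a (ℤ.- a))) (cong U (ℤP.+-inverseʳ a)))

  binomial-zpow : ∀ n a b →
    ∑< (suc n) (λ k → ι (binom n k) * U (+ 2 ℤ.* a ℤ.* + k ℤ.+ b)) ≡ U (a ℤ.* + n ℤ.+ b) * (U a + U (ℤ.- a)) ^ n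
  binomial-zpow n a b = begin
    ∑< (suc n) (λ k → ι (binom n k) * U (+ 2 ℤ.* a ℤ.* + k ℤ.+ b))
      ≡⟨ ∑<-cong (suc n) (λ k _ → split-term k) ⟩
    ∑< (suc n) (λ k → ι (binom n k) * (U (+ 2 ℤ.* a) ^ k * 1# ^ (n ∸ k)) * U b)
      ≡⟨ sym (∑<-distribʳ (suc n) (U b) (λ k → ι (binom n k) * (U (+ 2 ℤ.* a) ^ k * 1# ^ (n ∸ k)))) ⟩
    ∑< (suc n) (λ k → ι (binom n k) * (U (+ 2 ℤ.* a) ^ k * 1# ^ (n ∸ k))) * U b
      ≡⟨ cong (_* U b) (sym (binomial n (U (+ 2 ℤ.* a)) 1#)) ⟩
    (U (+ 2 ℤ.* a) + 1#) ^ n * U b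
      ≡⟨ cong (λ y → y ^ n * U b) (zpow-double+1 a) ⟩
    (U a * w) ^ n * U b
      ≡⟨ cong (_* U b) (^-distrib-* (U a) w n) ⟩
    U a ^ n * w ^ n * U b
      ≡⟨ xy∙z≈xz∙y (U a ^ n) (w ^ n) (U b) ⟩
    U a ^ n * U b * w ^ n
      ≡⟨ cong (_* w ^ n) (sym shift) ⟩
    U (a ℤ.* + n ℤ.+ b) * w ^ n ∎
    where
    w = U a + U (ℤ.- a)
    shift : U (a ℤ.* + n ℤ.+ b) ≡ U a ^ n * U b
    shift = trans (zpow-+ inverse (a ℤ.* + n) b)
                  (cong (_* U b) (trans (cong U (ℤP.*-comm a (+ n))) (zpow-*ℕ inverse n a)))
    split-term : ∀ k → ι (binom n k) * U (+ 2 ℤ.* a ℤ.* + k ℤ.+ b)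
                       ≡ ι (binom n k) * (U (+ 2 ℤ.* a) ^ k * 1# ^ (n ∸ k)) * U b
    split-term k = begin
      ι (binom n k) * U (+ 2 ℤ.* a ℤ.* + k ℤ.+ b)    ≡⟨ cong (ι (binom n k) *_) (zpow-+ inverse (+ 2 ℤ.* a ℤ.* + k) b) ⟩
      ι (binom n k) * (U (+ 2 ℤ.* a ℤ.* + k) * U b) ≡⟨ sym (*-assoc _ _ _) ⟩
      ι (binom n k) * U (+ 2 ℤ.* a ℤ.* + k) * U b   ≡⟨ cong (λ y → ι (binom n k) * y * U b) power ⟩
      ι (binom n k) * (U (+ 2 ℤ.* a) ^ k * 1# ^ (n ∸ k)) * U b ∎
      where
      power : U (+ 2 ℤ.* a ℤ.* + k) ≡ U (+ 2 ℤ.* a) ^ k * 1# ^ (n ∸ k)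
      power = begin
        U (+ 2 ℤ.* a ℤ.* + k)              ≡⟨ cong U (ℤP.*-comm (+ 2 ℤ.* a) (+ k)) ⟩
        U (+ k ℤ.* (+ 2 ℤ.* a))            ≡⟨ zpow-*ℕ inverse k (+ 2 ℤ.* a) ⟩
        U (+ 2 ℤ.* a) ^ k                  ≡⟨ sym (*-identityʳ _) ⟩
        U (+ 2 ℤ.* a) ^ k * 1#             ≡⟨ cong (_*_ (U (+ 2 ℤ.* a) ^ k)) (sym (1#^ (n ∸ k))) ⟩
        U (+ 2 ℤ.* a) ^ k * 1# ^ (n ∸ k)   ∎

-1^-2* : ∀ x → -1^ (+ 2 ℤ.* x) ≡ 1#
-1^-2* x = trans (-1^-*ℕ 2 x) (trans (cong (_*_ (-1^ x)) (*-identityʳ (-1^ x))) (-1^-involutive x))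

-1^-odd-multiple : ∀ {i m} → i ℕ.≤ m → ∀ a → -1^ (odd-coefficient m i ℤ.* a) ≡ -1^ a
-1^-odd-multiple {i} {m} i≤m a = begin
  -1^ (odd-coefficient m i ℤ.* a)       ≡⟨ cong (λ c → -1^ (c ℤ.* a)) (odd-coefficient≡ i≤m) ⟩
  -1^ (+ (2 ℕ.* (m ∸ i) ℕ.+ 1) ℤ.* a)   ≡⟨ -1^-*ℕ (2 ℕ.* (m ∸ i) ℕ.+ 1) a ⟩
  (-1^ a) ^ (2 ℕ.* (m ∸ i) ℕ.+ 1)       ≡⟨ involution-^-odd (-1^-involutive a) (m ∸ i) ⟩
  -1^ a                                 ∎

binomial-binet : ∀ ε n a b →
  ∑< (suc n) (λ k → ι (binom n k) * binet ε (+ 2 ℤ.* a ℤ.* + k ℤ.+ b))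
  ≡ binet (-1^ a) a ^ n * binet (ε * (-1^ a) ^ n) (a ℤ.* + n ℤ.+ b)
binomial-binet ε n a b = begin
  ∑< (suc n) (λ k → ι (binom n k) * binet ε (x k))
    ≡⟨ ∑<-cong (suc n) (λ k _ → distribute (ι (binom n k)) (φ^ (x k)) (ψ^ (x k))) ⟩
  ∑< (suc n) (λ k → ι (binom n k) * φ^ (x k) + ε * (ι (binom n k) * ψ^ (x k)))
    ≡⟨ ∑<-+ (suc n) (λ k → ι (binom n k) * φ^ (x k)) (λ k → ε * (ι (binom n k) * ψ^ (x k))) ⟩
  ∑< (suc n) (λ k → ι (binom n k) * φ^ (x k)) + ∑< (suc n) (λ k → ε * (ι (binom n k) * ψ^ (x k)))
    ≡⟨ cong (_+_ _) (sym (∑<-distribˡ (suc n) ε (λ k → ι (binom n k) * ψ^ (x k)))) ⟩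
  ∑< (suc n) (λ k → ι (binom n k) * φ^ (x k)) + ε * ∑< (suc n) (λ k → ι (binom n k) * ψ^ (x k))
    ≡⟨ cong₂ (λ p q → p + ε * q) (binomial-zpow refl n a b) (binomial-zpow refl n a b) ⟩
  φ^ y * (φ^ a + φ^ (ℤ.- a)) ^ n + ε * (ψ^ y * (ψ^ a + ψ^ (ℤ.- a)) ^ n)
    ≡⟨ cong₂ (λ p q → φ^ y * p ^ n + ε * (ψ^ y * q ^ n)) φ-pair ψ-pair ⟩
  φ^ y * W ^ n + ε * (ψ^ y * (σ * W) ^ n)
    ≡⟨ cong (λ q → φ^ y * W ^ n + ε * (ψ^ y * q)) (^-distrib-* σ W n) ⟩
  φ^ y * W ^ n + ε * (ψ^ y * (σ ^ n * W ^ n))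
    ≡⟨ factor ε (σ ^ n) (φ^ y) (ψ^ y) (W ^ n) ⟩
  W ^ n * binet (ε * σ ^ n) y ∎
  where
  x : ℕ → ℤ
  x k = + 2 ℤ.* a ℤ.* + k ℤ.+ b
  y = a ℤ.* + n ℤ.+ b
  σ = -1^ a
  W = binet σ a
  distribute : ∀ c p q → c * (p + ε * q) ≡ c * p + ε * (c * q)
  distribute c p q = trans (distribˡ c p (ε * q)) (cong (_+_ (c * p)) (x∙yz≈y∙xz c ε q))
  φ-pair : φ^ a + φ^ (ℤ.- a) ≡ W
  φ-pair = cong (_+_ (φ^ a)) (φ^-neg a)
  ψ-pair : ψ^ a + ψ^ (ℤ.- a) ≡ σ * W
  ψ-pair = trans (cong (_+_ (ψ^ a)) (ψ^-neg a)) (swap-sign (-1^-involutive a) (φ^ a) (ψ^ a))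
  factor : ∀ ε s p q w → p * w + ε * (q * (s * w)) ≡ w * (p + ε * s * q)
  factor = solve-∀ ℤ[φ]-ring

binet-sum : ∀ {ε} → ε * ε ≡ 1# → ∀ m n a b →
  ∑< (suc n) (λ k → ι (binom n k) * binet ε (+ 2 ℤ.* a ℤ.* + k ℤ.+ b) ^ (2 ℕ.* m ℕ.+ 1))
  ≡ ∑< (suc m) (λ i → ι (binom (2 ℕ.* m ℕ.+ 1) i) * ((ε * -1^ b) ^ i *
      (binet (-1^ a) (odd-coefficient m i ℤ.* a) ^ n
       * binet (ε * (-1^ a) ^ n) (odd-coefficient m i ℤ.* (a ℤ.* + n ℤ.+ b)))))
binet-sum {ε} ε²≡1 m n a b = begin
  ∑< (suc n) (λ k → ι (binom n k) * binet ε (x k) ^ N)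
    ≡⟨ ∑<-cong (suc n) (λ k _ → cong (ι (binom n k) *_) (expand k)) ⟩
  ∑< (suc n) (λ k → ι (binom n k) * ∑< (suc m) (λ i → T i * binet ε (c i ℤ.* x k)))
    ≡⟨ ∑<-cong (suc n) (λ k _ → ∑<-distribˡ (suc m) (ι (binom n k)) (λ i → T i * binet ε (c i ℤ.* x k))) ⟩
  ∑< (suc n) (λ k → ∑< (suc m) (λ i → ι (binom n k) * (T i * binet ε (c i ℤ.* x k))))
    ≡⟨ ∑<-comm (suc n) (suc m) (λ k i → ι (binom n k) * (T i * binet ε (c i ℤ.* x k))) ⟩
  ∑< (suc m) (λ i → ∑< (suc n) (λ k → ι (binom n k) * (T i * binet ε (c i ℤ.* x k))))
    ≡⟨ ∑<-cong (suc m) (λ i i<1+m → inner (ℕP.m<1+n⇒m≤n i<1+m)) ⟩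
  _ ∎
  where
  N = 2 ℕ.* m ℕ.+ 1
  c = odd-coefficient m
  x : ℕ → ℤ
  x k = + 2 ℤ.* a ℤ.* + k ℤ.+ b
  T : ℕ → ℤ[φ]
  T i = ι (binom N i) * (ε * -1^ b) ^ i
  sign : ∀ k → -1^ (x k) ≡ -1^ b
  sign k = begin
    -1^ (x k)                              ≡⟨ -1^-+ (+ 2 ℤ.* a ℤ.* + k) b ⟩
    -1^ (+ 2 ℤ.* a ℤ.* + k) * -1^ b        ≡⟨ cong (λ z → -1^ z * -1^ b) (ℤP.*-assoc (+ 2) a (+ k)) ⟩
    -1^ (+ 2 ℤ.* (a ℤ.* + k)) * -1^ b      ≡⟨ cong (_* -1^ b) (-1^-2* (a ℤ.* + k)) ⟩
    1# * -1^ b                             ≡⟨ *-identityˡ (-1^ b) ⟩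
    -1^ b                                  ∎
  expand : ∀ k → binet ε (x k) ^ N ≡ ∑< (suc m) (λ i → T i * binet ε (c i ℤ.* x k))
  expand k = trans (binet-odd-power ε²≡1 m (x k))
    (∑<-cong (suc m) (λ i _ → trans (cong (λ s → ι (binom N i) * ((ε * s) ^ i * binet ε (c i ℤ.* x k))) (sign k))
                                    (sym (*-assoc _ _ _))))
  index : ∀ c a k b → c ℤ.* (+ 2 ℤ.* a ℤ.* k ℤ.+ b) ≡ + 2 ℤ.* (c ℤ.* a) ℤ.* k ℤ.+ c ℤ.* b
  index = ℤSolver.solve-∀
  inner : ∀ {i} → i ℕ.≤ m →
    ∑< (suc n) (λ k → ι (binom n k) * (T i * binet ε (c i ℤ.* x k)))
    ≡ ι (binom N i) * ((ε * -1^ b) ^ i *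
        (binet (-1^ a) (c i ℤ.* a) ^ n * binet (ε * (-1^ a) ^ n) (c i ℤ.* (a ℤ.* + n ℤ.+ b))))
  inner {i} i≤m = begin
    ∑< (suc n) (λ k → ι (binom n k) * (T i * binet ε (c i ℤ.* x k)))
      ≡⟨ ∑<-cong (suc n) (λ k _ → trans (x∙yz≈y∙xz (ι (binom n k)) (T i) _)
                                          (cong (λ z → T i * (ι (binom n k) * binet ε z)) (index (c i) a (+ k) b))) ⟩
    ∑< (suc n) (λ k → T i * (ι (binom n k) * binet ε (+ 2 ℤ.* (c i ℤ.* a) ℤ.* + k ℤ.+ c i ℤ.* b)))
      ≡⟨ sym (∑<-distribˡ (suc n) (T i)
                (λ k → ι (binom n k) * binet ε (+ 2 ℤ.* (c i ℤ.* a) ℤ.* + k ℤ.+ c i ℤ.* b))) ⟩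
    T i * ∑< (suc n) (λ k → ι (binom n k) * binet ε (+ 2 ℤ.* (c i ℤ.* a) ℤ.* + k ℤ.+ c i ℤ.* b))
      ≡⟨ cong (T i *_) (binomial-binet ε n (c i ℤ.* a) (c i ℤ.* b)) ⟩
    T i * (binet (-1^ (c i ℤ.* a)) (c i ℤ.* a) ^ n
           * binet (ε * (-1^ (c i ℤ.* a)) ^ n) (c i ℤ.* a ℤ.* + n ℤ.+ c i ℤ.* b))
      ≡⟨ cong₂ (λ σ y → T i * (binet σ (c i ℤ.* a) ^ n * binet (ε * σ ^ n) y))
               (-1^-odd-multiple i≤m a) (regroup (c i) a (+ n) b) ⟩
    T i * (binet (-1^ a) (c i ℤ.* a) ^ n * binet (ε * (-1^ a) ^ n) (c i ℤ.* (a ℤ.* + n ℤ.+ b)))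
      ≡⟨ *-assoc _ _ _ ⟩
    _ ∎
    where
    regroup : ∀ c a n b → c ℤ.* a ℤ.* n ℤ.+ c ℤ.* b ≡ c ℤ.* (a ℤ.* n ℤ.+ b)
    regroup = ℤSolver.solve-∀

-- Clearing powers of √5

φ-part : ℤ[φ] → ℤ
φ-part (_ + b ·φ) = b

*-ι : ∀ a b z → (a + b ·φ) * ι z ≡ (a ℤ.* z) + (b ℤ.* z) ·φ
*-ι a b z = cong₂ _+_·φ (ℤSolver.solve (a ∷ b ∷ z ∷ [])) (ℤSolver.solve (a ∷ b ∷ z ∷ []))

√5-cancelʳ : ∀ {x y} → x * √5 ≡ y * √5 → x ≡ y
√5-cancelʳ {a + b ·φ} {c + d ·φ} eq =
  cong₂ _+_·φ (ℤP.*-cancelʳ-≡ a c (+ 5) (cong rational-part times5))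
              (ℤP.*-cancelʳ-≡ b d (+ 5) (cong φ-part times5))
  where
  -- √5 * √5 reduces to ι (+ 5)
  times5 : (a ℤ.* + 5) + (b ℤ.* + 5) ·φ ≡ (c ℤ.* + 5) + (d ℤ.* + 5) ·φ
  times5 = begin
    (a ℤ.* + 5) + (b ℤ.* + 5) ·φ  ≡⟨ sym (*-ι a b (+ 5)) ⟩
    (a + b ·φ) * (√5 * √5)        ≡⟨ sym (*-assoc (a + b ·φ) √5 √5) ⟩
    (a + b ·φ) * √5 * √5          ≡⟨ cong (_* √5) eq ⟩
    (c + d ·φ) * √5 * √5          ≡⟨ *-assoc (c + d ·φ) √5 √5 ⟩
    (c + d ·φ) * (√5 * √5)        ≡⟨ *-ι c d (+ 5) ⟩
    (c ℤ.* + 5) + (d ℤ.* + 5) ·φ  ∎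

√5^-cancelʳ : ∀ e {x y} → x * √5 ^ e ≡ y * √5 ^ e → x ≡ y
√5^-cancelʳ zero {x} {y} eq = trans (sym (*-identityʳ x)) (trans eq (*-identityʳ y))
√5^-cancelʳ (suc e) {x} {y} eq =
  √5-cancelʳ (√5^-cancelʳ e (trans (*-assoc x √5 _) (trans eq (sym (*-assoc y √5 _)))))

√5^-even : ∀ a → √5 ^ (2 ℕ.* a) ≡ ι ((+ 5) ℤ.^ a)
√5^-even a = trans (sym (^-assocʳ √5 2 a)) (sym (ι-^ (+ 5) a))

toℚ-* : ∀ a b → toℚ (a ℤ.* b) ≡ toℚ a ℚ.* toℚ b
toℚ-* a b = ℚP.toℚᵘ-injective (ℚᵘP.≃-sym (ℚᵘP.≃-trans (ℚP.toℚᵘ-homo-* (toℚ a) (toℚ b))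
  (ℚᵘP.≃-trans (ℚᵘP.*-cong (ℚP.toℚᵘ-fromℚᵘ (ℚᵘ.mkℚᵘ a 0)) (ℚP.toℚᵘ-fromℚᵘ (ℚᵘ.mkℚᵘ b 0)))
               (ℚᵘP.≃-sym (ℚP.toℚᵘ-fromℚᵘ (ℚᵘ.mkℚᵘ (a ℤ.* b) 0))))))

5ℚ 1/5 : ℚ
5ℚ = + 5 ℚ./ 1
1/5 = ℚ.1ℚ ℚ.÷ 5ℚ

ℚ-ring : ACR.AlmostCommutativeRing 0ℓ 0ℓ
ℚ-ring = ACR.fromCommutativeRing ℚP.+-*-commutativeRing (λ _ → nothing)

toℚ-5^ : ∀ a → toℚ ((+ 5) ℤ.^ a) ≡ 5ℚ ^ℚ a
toℚ-5^ zero = refl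
toℚ-5^ (suc a) = trans (toℚ-* (+ 5) ((+ 5) ℤ.^ a)) (cong (5ℚ ℚ.*_) (toℚ-5^ a))

pow5-⊖ : ∀ b a → pow5 (b ⊖ a) ≡ 1/5 ^ℚ a ℚ.* 5ℚ ^ℚ b
pow5-⊖ b zero = sym (ℚP.*-identityˡ _)
pow5-⊖ zero (suc a) = sym (ℚP.*-identityʳ _)
pow5-⊖ (suc b) (suc a) = begin
  pow5 (suc b ⊖ suc a)                               ≡⟨ cong pow5 (ℤP.[1+m]⊖[1+n]≡m⊖n b a) ⟩
  pow5 (b ⊖ a)                                       ≡⟨ pow5-⊖ b a ⟩
  1/5 ^ℚ a ℚ.* 5ℚ ^ℚ b                               ≡⟨ sym (ℚP.*-identityˡ _) ⟩
  ℚ.1ℚ ℚ.* (1/5 ^ℚ a ℚ.* 5ℚ ^ℚ b)                    ≡⟨ cong (ℚ._* (1/5 ^ℚ a ℚ.* 5ℚ ^ℚ b)) (sym 1/5*5) ⟩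
  (1/5 ℚ.* 5ℚ) ℚ.* (1/5 ^ℚ a ℚ.* 5ℚ ^ℚ b)            ≡⟨ interchange 1/5 5ℚ (1/5 ^ℚ a) (5ℚ ^ℚ b) ⟩
  (1/5 ℚ.* 1/5 ^ℚ a) ℚ.* (5ℚ ℚ.* 5ℚ ^ℚ b)            ∎
  where
  1/5*5 : 1/5 ℚ.* 5ℚ ≡ ℚ.1ℚ
  1/5*5 = trans (cong (ℚ._* 5ℚ) (ℚP.*-identityˡ (ℚ.1/ 5ℚ))) (ℚP.*-inverseˡ 5ℚ)
  interchange : ∀ a b c d → (a ℚ.* b) ℚ.* (c ℚ.* d) ≡ (a ℚ.* c) ℚ.* (b ℚ.* d)
  interchange = solve-∀ ℚ-ring

5^-scaled⇒ℚ : ∀ a b {X Y} → (+ 5) ℤ.^ a ℤ.* X ≡ (+ 5) ℤ.^ b ℤ.* Y → toℚ X ≡ pow5 (b ⊖ a) ℚ.* toℚ Y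
5^-scaled⇒ℚ a b {X} {Y} eq = begin
  toℚ X                                   ≡⟨ sym (ℚP.*-identityˡ _) ⟩
  ℚ.1ℚ ℚ.* toℚ X                          ≡⟨ cong (λ q → pow5 q ℚ.* toℚ X) (sym (ℤP.n⊖n≡0 a)) ⟩
  pow5 (a ⊖ a) ℚ.* toℚ X                  ≡⟨ cong (ℚ._* toℚ X) (pow5-⊖ a a) ⟩
  1/5 ^ℚ a ℚ.* 5ℚ ^ℚ a ℚ.* toℚ X          ≡⟨ ℚP.*-assoc (1/5 ^ℚ a) (5ℚ ^ℚ a) (toℚ X) ⟩
  1/5 ^ℚ a ℚ.* (5ℚ ^ℚ a ℚ.* toℚ X)        ≡⟨ cong (1/5 ^ℚ a ℚ.*_) (sym (scaled a X)) ⟩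
  1/5 ^ℚ a ℚ.* toℚ ((+ 5) ℤ.^ a ℤ.* X)    ≡⟨ cong (λ z → 1/5 ^ℚ a ℚ.* toℚ z) eq ⟩
  1/5 ^ℚ a ℚ.* toℚ ((+ 5) ℤ.^ b ℤ.* Y)    ≡⟨ cong (1/5 ^ℚ a ℚ.*_) (scaled b Y) ⟩
  1/5 ^ℚ a ℚ.* (5ℚ ^ℚ b ℚ.* toℚ Y)        ≡⟨ sym (ℚP.*-assoc (1/5 ^ℚ a) (5ℚ ^ℚ b) (toℚ Y)) ⟩
  1/5 ^ℚ a ℚ.* 5ℚ ^ℚ b ℚ.* toℚ Y          ≡⟨ cong (ℚ._* toℚ Y) (sym (pow5-⊖ b a)) ⟩
  pow5 (b ⊖ a) ℚ.* toℚ Y                  ∎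
  where
  scaled : ∀ a Z → toℚ ((+ 5) ℤ.^ a ℤ.* Z) ≡ 5ℚ ^ℚ a ℚ.* toℚ Z
  scaled a Z = trans (toℚ-* ((+ 5) ℤ.^ a) Z) (cong (ℚ._* toℚ Z) (toℚ-5^ a))

√5-weighted⇒ℚ : ∀ a b e {X Y p q z} → ι X * √5 ^ p ≡ ι Y * √5 ^ q →
  p ≡ 2 ℕ.* a ℕ.+ e → q ≡ 2 ℕ.* b ℕ.+ e → z ≡ b ⊖ a → toℚ X ≡ pow5 z ℚ.* toℚ Y
√5-weighted⇒ℚ a b e {X} {Y} eq refl refl refl =
  5^-scaled⇒ℚ a b (ι-injective (√5^-cancelʳ e (begin
    ι ((+ 5) ℤ.^ a ℤ.* X) * √5 ^ e  ≡⟨ sym (absorb a X) ⟩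
    ι X * √5 ^ (2 ℕ.* a ℕ.+ e)      ≡⟨ eq ⟩
    ι Y * √5 ^ (2 ℕ.* b ℕ.+ e)      ≡⟨ absorb b Y ⟩
    ι ((+ 5) ℤ.^ b ℤ.* Y) * √5 ^ e  ∎)))
  where
  absorb : ∀ a Z → ι Z * √5 ^ (2 ℕ.* a ℕ.+ e) ≡ ι ((+ 5) ℤ.^ a ℤ.* Z) * √5 ^ e
  absorb a Z = begin
    ι Z * √5 ^ (2 ℕ.* a ℕ.+ e)
      ≡⟨ cong (ι Z *_) (trans (^-homo-* √5 (2 ℕ.* a) e) (cong (_* √5 ^ e) (√5^-even a))) ⟩
    ι Z * (ι ((+ 5) ℤ.^ a) * √5 ^ e)  ≡⟨ x∙yz≈yx∙z (ι Z) (ι ((+ 5) ℤ.^ a)) (√5 ^ e) ⟩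
    ι ((+ 5) ℤ.^ a) * ι Z * √5 ^ e    ≡⟨ cong (_* √5 ^ e) (sym (ι-* ((+ 5) ℤ.^ a) Z)) ⟩
    ι ((+ 5) ℤ.^ a ℤ.* Z) * √5 ^ e    ∎

even⊎odd : ∀ n → (∃ λ q → n ≡ 2 ℕ.* q) ⊎ (∃ λ q → n ≡ 2 ℕ.* q ℕ.+ 1)
even⊎odd zero = inj₁ (0 , refl)
even⊎odd (suc n) with even⊎odd n
... | inj₁ (q , refl) = inj₂ (q , ℕP.+-comm 1 (2 ℕ.* q))
... | inj₂ (q , refl) = inj₁ (suc q , next-even q)
  where
  next-even : ∀ q → suc (2 ℕ.* q ℕ.+ 1) ≡ 2 ℕ.* suc q
  next-even = ℕSolver.solve-∀

2∣⇒even : ∀ {n} → 2 ℕD.∣ n → ∃ λ q → n ≡ 2 ℕ.* q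
2∣⇒even (divides q n≡q*2) = q , trans n≡q*2 (ℕP.*-comm q 2)

2∤⇒odd : ∀ {n} → ¬ 2 ℕD.∣ n → ∃ λ q → n ≡ 2 ℕ.* q ℕ.+ 1
2∤⇒odd {n} 2∤n with even⊎odd n
... | inj₁ (q , n≡2q) = contradiction (divides q (trans n≡2q (ℕP.*-comm 2 q))) 2∤n
... | inj₂ odd-n = odd-n

-1^-abs : ∀ x → -1^ x ≡ (- 1#) ^ ℤ.∣ x ∣
-1^-abs (+ n) = refl
-1^-abs -[1+ n ] = refl

-1^-even : ∀ x → 2 ℕD.∣ ℤ.∣ x ∣ → -1^ x ≡ 1#
-1^-even x 2∣x with 2∣⇒even 2∣x
... | q , ∣x∣≡2q = begin
  -1^ x                   ≡⟨ trans (-1^-abs x) (cong ((- 1#) ^_) ∣x∣≡2q) ⟩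
  (- 1#) ^ (2 ℕ.* q)      ≡⟨ sym (^-assocʳ (- 1#) 2 q) ⟩
  1# ^ q                  ≡⟨ 1#^ q ⟩
  1#                      ∎

-1^-odd : ∀ x → ¬ 2 ℕD.∣ ℤ.∣ x ∣ → -1^ x ≡ - 1#
-1^-odd x 2∤x with 2∤⇒odd 2∤x
... | q , ∣x∣≡2q+1 = trans (trans (-1^-abs x) (cong ((- 1#) ^_) ∣x∣≡2q+1)) (involution-^-odd refl q)

-1^-suc : ∀ x → -1^ (x ℤ.+ + 1) ≡ - 1# * -1^ x
-1^-suc x = trans (-1^-+ x (+ 1)) (*-comm (-1^ x) (- 1#))

-1^-id : ∀ x → -1^ x ≡ 1# * -1^ x
-1^-id x = sym (*-identityˡ (-1^ x))

neg≡0⊖ : ∀ a → ℤ.- (+ a) ≡ 0 ⊖ a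
neg≡0⊖ zero = refl
neg≡0⊖ (suc a) = refl

half : ∀ {n q} → n ≡ 2 ℕ.* q → n ℕ./ 2 ≡ q
half {q = q} refl = trans (cong (ℕ._/ 2) (ℕP.*-comm 2 q)) (m*n/n≡m q 2)

odd-suc : ∀ q → 2 ℕ.* q ℕ.+ 1 ℕ.+ 1 ≡ 2 ℕ.* suc q
odd-suc = ℕSolver.solve-∀

open BinetSequence

module _ (m n : ℕ) (j r s : ℤ) where

  private
    N = 2 ℕ.* m ℕ.+ 1
    c = odd-coefficient m

  power-summand : (ℤ → ℤ) → ℕ → ℤ
  power-summand G k = binom n k ℤ.* G (j ℤ.* (+ 2 ℤ.* r ℤ.* + k ℤ.+ s)) ℤ.^ N

  power-sum : (ℤ → ℤ) → ℤ
  power-sum G = sumTo n (power-summand G)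

  reduced-summand : (ℤ → ℤ) → (ℤ → ℤ) → (ℤ → ℤ) → ℕ → ℤ
  reduced-summand G₁ G₂ τ i =
    neg1^ (+ i ℤ.* τ (j ℤ.* s)) ℤ.* binom N i ℤ.* G₁ (c i ℤ.* j ℤ.* r) ℤ.^ n
    ℤ.* G₂ (c i ℤ.* (j ℤ.* r ℤ.* + n ℤ.+ j ℤ.* s))

  reduced-sum : (ℤ → ℤ) → (ℤ → ℤ) → (ℤ → ℤ) → ℤ
  reduced-sum G₁ G₂ τ = sumTo m (reduced-summand G₁ G₂ τ)

  power-summand-binet : ∀ (𝔾 : BinetSequence) k →
    ι (power-summand (seq 𝔾) k) * √5 ^ (weight 𝔾 ℕ.* N)
    ≡ ι (binom n k) * binet (sign 𝔾) (+ 2 ℤ.* (j ℤ.* r) ℤ.* + k ℤ.+ j ℤ.* s) ^ N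
  power-summand-binet 𝔾 k = begin
    ι (binom n k ℤ.* G ℤ.^ N) * √5 ^ (weight 𝔾 ℕ.* N)
      ≡⟨ cong₂ _*_ (trans (ι-* (binom n k) (G ℤ.^ N)) (cong (ι (binom n k) *_) (ι-^ G N)))
                   (sym (^-assocʳ √5 (weight 𝔾) N)) ⟩
    ι (binom n k) * ι G ^ N * (√5 ^ weight 𝔾) ^ N
      ≡⟨ *-assoc (ι (binom n k)) (ι G ^ N) ((√5 ^ weight 𝔾) ^ N) ⟩
    ι (binom n k) * (ι G ^ N * (√5 ^ weight 𝔾) ^ N)
      ≡⟨ cong (ι (binom n k) *_) (sym (^-distrib-* (ι G) (√5 ^ weight 𝔾) N)) ⟩
    ι (binom n k) * (ι G * √5 ^ weight 𝔾) ^ N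
      ≡⟨ cong (λ y → ι (binom n k) * y ^ N) (formula 𝔾 (j ℤ.* (+ 2 ℤ.* r ℤ.* + k ℤ.+ s))) ⟩
    ι (binom n k) * binet (sign 𝔾) (j ℤ.* (+ 2 ℤ.* r ℤ.* + k ℤ.+ s)) ^ N
      ≡⟨ cong (λ y → ι (binom n k) * binet (sign 𝔾) y ^ N) (regroup j r (+ k) s) ⟩
    ι (binom n k) * binet (sign 𝔾) (+ 2 ℤ.* (j ℤ.* r) ℤ.* + k ℤ.+ j ℤ.* s) ^ N ∎
    where
    G = seq 𝔾 (j ℤ.* (+ 2 ℤ.* r ℤ.* + k ℤ.+ s))
    regroup : ∀ j r k s → j ℤ.* (+ 2 ℤ.* r ℤ.* k ℤ.+ s) ≡ + 2 ℤ.* (j ℤ.* r) ℤ.* k ℤ.+ j ℤ.* s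
    regroup = ℤSolver.solve-∀

  reduced-summand-binet : ∀ (𝔾 𝔾₁ 𝔾₂ : BinetSequence) τ → (∀ x → -1^ (τ x) ≡ sign 𝔾 * -1^ x) →
    -1^ (j ℤ.* r) ≡ sign 𝔾₁ → sign 𝔾₂ ≡ sign 𝔾 * sign 𝔾₁ ^ n → ∀ i →
    ι (reduced-summand (seq 𝔾₁) (seq 𝔾₂) τ i) * √5 ^ (weight 𝔾₁ ℕ.* n ℕ.+ weight 𝔾₂)
    ≡ ι (binom N i) * ((sign 𝔾 * -1^ (j ℤ.* s)) ^ i *
        (binet (-1^ (j ℤ.* r)) (c i ℤ.* (j ℤ.* r)) ^ n
         * binet (sign 𝔾 * (-1^ (j ℤ.* r)) ^ n) (c i ℤ.* (j ℤ.* r ℤ.* + n ℤ.+ j ℤ.* s))))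
  reduced-summand-binet 𝔾 𝔾₁ 𝔾₂ τ τ-sign σ≡ ε₂≡ i = begin
    ι (t ℤ.* binom N i ℤ.* g₁ ℤ.^ n ℤ.* g₂) * √5 ^ (e₁ ℕ.* n ℕ.+ e₂)
      ≡⟨ cong₂ _*_ ι-product √5-split ⟩
    ι t * ι (binom N i) * ι g₁ ^ n * ι g₂ * ((√5 ^ e₁) ^ n * √5 ^ e₂)
      ≡⟨ regroup (ι t) (ι (binom N i)) (ι g₁ ^ n) (ι g₂) ((√5 ^ e₁) ^ n) (√5 ^ e₂) ⟩
    ι (binom N i) * (ι t * ((ι g₁ ^ n * (√5 ^ e₁) ^ n) * (ι g₂ * √5 ^ e₂)))
      ≡⟨ cong (λ y → ι (binom N i) * (ι t * (y * (ι g₂ * √5 ^ e₂)))) (sym (^-distrib-* (ι g₁) (√5 ^ e₁) n)) ⟩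
    ι (binom N i) * (ι t * ((ι g₁ * √5 ^ e₁) ^ n * (ι g₂ * √5 ^ e₂)))
      ≡⟨ cong (ι (binom N i) *_) (cong₂ _*_ sign-power (cong₂ (λ p q → p ^ n * q) (formula 𝔾₁ _) (formula 𝔾₂ _))) ⟩
    ι (binom N i) * ((ε * -1^ (j ℤ.* s)) ^ i * (binet (sign 𝔾₁) (c i ℤ.* j ℤ.* r) ^ n * binet (sign 𝔾₂) y))
      ≡⟨ cong₂ (λ p q → ι (binom N i) * ((ε * -1^ (j ℤ.* s)) ^ i * (p ^ n * binet q y)))
               (cong₂ binet (sym σ≡) (ℤP.*-assoc (c i) j r)) (trans ε₂≡ (cong (λ σ → ε * σ ^ n) (sym σ≡))) ⟩
    ι (binom N i) * ((ε * -1^ (j ℤ.* s)) ^ i *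
        (binet (-1^ (j ℤ.* r)) (c i ℤ.* (j ℤ.* r)) ^ n * binet (ε * (-1^ (j ℤ.* r)) ^ n) y)) ∎
    where
    ε = sign 𝔾
    e₁ = weight 𝔾₁
    e₂ = weight 𝔾₂
    t = neg1^ (+ i ℤ.* τ (j ℤ.* s))
    y = c i ℤ.* (j ℤ.* r ℤ.* + n ℤ.+ j ℤ.* s)
    g₁ = seq 𝔾₁ (c i ℤ.* j ℤ.* r)
    g₂ = seq 𝔾₂ y
    ι-product : ι (t ℤ.* binom N i ℤ.* g₁ ℤ.^ n ℤ.* g₂) ≡ ι t * ι (binom N i) * ι g₁ ^ n * ι g₂
    ι-product = trans (ι-* (t ℤ.* binom N i ℤ.* g₁ ℤ.^ n) g₂) (cong (_* ι g₂)
      (trans (ι-* (t ℤ.* binom N i) (g₁ ℤ.^ n)) (cong₂ _*_ (ι-* t (binom N i)) (ι-^ g₁ n))))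
    √5-split : √5 ^ (e₁ ℕ.* n ℕ.+ e₂) ≡ (√5 ^ e₁) ^ n * √5 ^ e₂
    √5-split = trans (^-homo-* √5 (e₁ ℕ.* n) e₂) (cong (_* √5 ^ e₂) (sym (^-assocʳ √5 e₁ n)))
    sign-power : ι t ≡ (ε * -1^ (j ℤ.* s)) ^ i
    sign-power = trans (ι-neg1^ (+ i ℤ.* τ (j ℤ.* s)))
                       (trans (-1^-*ℕ i (τ (j ℤ.* s))) (cong (_^ i) (τ-sign (j ℤ.* s))))
    regroup : ∀ t b G g R S → t * b * G * g * (R * S) ≡ b * (t * ((G * R) * (g * S)))
    regroup = solve-∀ ℤ[φ]-ring

  power-sum-in-ℤ[φ] : ∀ (𝔾 𝔾₁ 𝔾₂ : BinetSequence) τ → (∀ x → -1^ (τ x) ≡ sign 𝔾 * -1^ x) →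
    -1^ (j ℤ.* r) ≡ sign 𝔾₁ → sign 𝔾₂ ≡ sign 𝔾 * sign 𝔾₁ ^ n →
    ι (power-sum (seq 𝔾)) * √5 ^ (weight 𝔾 ℕ.* N)
    ≡ ι (reduced-sum (seq 𝔾₁) (seq 𝔾₂) τ) * √5 ^ (weight 𝔾₁ ℕ.* n ℕ.+ weight 𝔾₂)
  power-sum-in-ℤ[φ] 𝔾 𝔾₁ 𝔾₂ τ τ-sign σ≡ ε₂≡ = begin
    ι (power-sum (seq 𝔾)) * √5 ^ (weight 𝔾 ℕ.* N)
      ≡⟨ ι-sumTo-*ʳ n (power-summand (seq 𝔾)) (√5 ^ (weight 𝔾 ℕ.* N)) ⟩
    ∑< (suc n) (λ k → ι (power-summand (seq 𝔾) k) * √5 ^ (weight 𝔾 ℕ.* N))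
      ≡⟨ ∑<-cong (suc n) (λ k _ → power-summand-binet 𝔾 k) ⟩
    ∑< (suc n) (λ k → ι (binom n k) * binet (sign 𝔾) (+ 2 ℤ.* (j ℤ.* r) ℤ.* + k ℤ.+ j ℤ.* s) ^ N)
      ≡⟨ binet-sum (sign² 𝔾) m n (j ℤ.* r) (j ℤ.* s) ⟩
    ∑< (suc m) (λ i → ι (binom N i) * ((sign 𝔾 * -1^ (j ℤ.* s)) ^ i *
      (binet (-1^ (j ℤ.* r)) (c i ℤ.* (j ℤ.* r)) ^ n
       * binet (sign 𝔾 * (-1^ (j ℤ.* r)) ^ n) (c i ℤ.* (j ℤ.* r ℤ.* + n ℤ.+ j ℤ.* s)))))
      ≡⟨ ∑<-cong (suc m) (λ i _ → sym (reduced-summand-binet 𝔾 𝔾₁ 𝔾₂ τ τ-sign σ≡ ε₂≡ i)) ⟩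
    ∑< (suc m) (λ i → ι (reduced-summand (seq 𝔾₁) (seq 𝔾₂) τ i) * √5 ^ (weight 𝔾₁ ℕ.* n ℕ.+ weight 𝔾₂))
      ≡⟨ sym (ι-sumTo-*ʳ m (reduced-summand (seq 𝔾₁) (seq 𝔾₂) τ) _) ⟩
    ι (reduced-sum (seq 𝔾₁) (seq 𝔾₂) τ) * √5 ^ (weight 𝔾₁ ℕ.* n ℕ.+ weight 𝔾₂) ∎

  binet-power-sum-identity : ∀ (𝔾 𝔾₁ 𝔾₂ : BinetSequence) τ a b e {z} →
    (∀ x → -1^ (τ x) ≡ sign 𝔾 * -1^ x) → -1^ (j ℤ.* r) ≡ sign 𝔾₁ → sign 𝔾₂ ≡ sign 𝔾 * sign 𝔾₁ ^ n →
    weight 𝔾 ℕ.* N ≡ 2 ℕ.* a ℕ.+ e → weight 𝔾₁ ℕ.* n ℕ.+ weight 𝔾₂ ≡ 2 ℕ.* b ℕ.+ e →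
    z ≡ b ⊖ a → toℚ (power-sum (seq 𝔾)) ≡ pow5 z ℚ.* toℚ (reduced-sum (seq 𝔾₁) (seq 𝔾₂) τ)
  binet-power-sum-identity 𝔾 𝔾₁ 𝔾₂ τ a b e τ-sign σ≡ ε₂≡ =
    √5-weighted⇒ℚ a b e (power-sum-in-ℤ[φ] 𝔾 𝔾₁ 𝔾₂ τ τ-sign σ≡ ε₂≡)

  private
    weight-exponent : ∀ {k} e → n ≡ k → 1 ℕ.* n ℕ.+ e ≡ k ℕ.+ e
    weight-exponent e n≡k = cong (ℕ._+ e) (trans (ℕP.*-identityˡ n) n≡k)

  fibonacci-sum-jr-even : + 2 ℤD.∣ j ℤ.* r →
    toℚ (power-sum F) ≡ pow5 (ℤ.- (+ m)) ℚ.* toℚ (reduced-sum L F (ℤ._+ + 1))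
  fibonacci-sum-jr-even 2∣jr = binet-power-sum-identity fibonacci lucas fibonacci (ℤ._+ + 1) m 0 1
    -1^-suc (-1^-even (j ℤ.* r) 2∣jr) (sym (cong (_*_ (- 1#)) (1#^ n)))
    (ℕP.*-identityˡ _) refl (neg≡0⊖ m)

  fibonacci-sum-jr-odd-n-even : ¬ (+ 2 ℤD.∣ j ℤ.* r) → 2 ℕD.∣ n →
    toℚ (power-sum F) ≡ pow5 (+ (n ℕ./ 2) ℤ.- + m) ℚ.* toℚ (reduced-sum F F (ℤ._+ + 1))
  fibonacci-sum-jr-odd-n-even 2∤jr 2∣n with 2∣⇒even 2∣n
  ... | q , n≡2q = binet-power-sum-identity fibonacci fibonacci fibonacci (ℤ._+ + 1) m q 1
    -1^-suc (-1^-odd (j ℤ.* r) 2∤jr) (sym (cong (_*_ (- 1#)) (-1^-even (+ n) 2∣n)))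
    (ℕP.*-identityˡ _) (weight-exponent 1 n≡2q) (trans (cong (λ h → + h ℤ.- + m) (half n≡2q)) (ℤP.m-n≡m⊖n q m))

  fibonacci-sum-jr-odd-n-odd : ¬ (+ 2 ℤD.∣ j ℤ.* r) → ¬ (2 ℕD.∣ n) →
    toℚ (power-sum F) ≡ pow5 (+ ((n ∸ 1) ℕ./ 2) ℤ.- + m) ℚ.* toℚ (reduced-sum F L (ℤ._+ + 1))
  fibonacci-sum-jr-odd-n-odd 2∤jr 2∤n with 2∤⇒odd 2∤n
  ... | q , n≡2q+1 = binet-power-sum-identity fibonacci fibonacci lucas (ℤ._+ + 1) m q 1
    -1^-suc (-1^-odd (j ℤ.* r) 2∤jr) (sym (cong (_*_ (- 1#)) (-1^-odd (+ n) 2∤n)))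
    (ℕP.*-identityˡ _) (trans (weight-exponent 0 n≡2q+1) (ℕP.+-identityʳ _))
    (trans (cong (λ h → + h ℤ.- + m) (half (trans (cong (_∸ 1) n≡2q+1) (ℕP.m+n∸n≡m (2 ℕ.* q) 1))))
           (ℤP.m-n≡m⊖n q m))

  lucas-sum-jr-even : + 2 ℤD.∣ j ℤ.* r → toℚ (power-sum L) ≡ toℚ (reduced-sum L L id)
  lucas-sum-jr-even 2∣jr = trans
    (binet-power-sum-identity lucas lucas lucas id 0 0 0 {z = + 0}
      -1^-id (-1^-even (j ℤ.* r) 2∣jr) (sym (cong (_*_ 1#) (1#^ n)))
      refl refl refl)
    (ℚP.*-identityˡ _)

  lucas-sum-jr-odd-n-even : ¬ (+ 2 ℤD.∣ j ℤ.* r) → 2 ℕD.∣ n →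
    toℚ (power-sum L) ≡ pow5 (+ (n ℕ./ 2)) ℚ.* toℚ (reduced-sum F L id)
  lucas-sum-jr-odd-n-even 2∤jr 2∣n with 2∣⇒even 2∣n
  ... | q , n≡2q = binet-power-sum-identity lucas fibonacci lucas id 0 q 0
    -1^-id (-1^-odd (j ℤ.* r) 2∤jr) (sym (cong (_*_ 1#) (-1^-even (+ n) 2∣n)))
    refl (weight-exponent 0 n≡2q) (cong +_ (half n≡2q))

  lucas-sum-jr-odd-n-odd : ¬ (+ 2 ℤD.∣ j ℤ.* r) → ¬ (2 ℕD.∣ n) →
    toℚ (power-sum L) ≡ pow5 (+ ((n ℕ.+ 1) ℕ./ 2)) ℚ.* toℚ (reduced-sum F F id)
  lucas-sum-jr-odd-n-odd 2∤jr 2∤n with 2∤⇒odd 2∤n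
  ... | q , n≡2q+1 = binet-power-sum-identity lucas fibonacci fibonacci id 0 (suc q) 0
    -1^-id (-1^-odd (j ℤ.* r) 2∤jr) (sym (cong (_*_ 1#) (-1^-odd (+ n) 2∤n)))
    refl (trans (weight-exponent 1 n≡2q+1) (trans (odd-suc q) (sym (ℕP.+-identityʳ _))))
    (cong +_ (half (trans (cong (ℕ._+ 1) n≡2q+1) (odd-suc q))))

theorem5 : (m n : ℕ) (j r s : ℤ) →
  -- Fibonacci sum
  ((+ 2 ℤD.∣ j ℤ.* r →
      toℚ (sumTo n (λ k → binom n k ℤ.* F (j ℤ.* (+ 2 ℤ.* r ℤ.* + k ℤ.+ s)) ℤ.^ (2 ℕ.* m ℕ.+ 1)))
      ≡ pow5 (ℤ.- (+ m)) ℚ.* toℚ (sumTo m (λ i →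
          neg1^ (+ i ℤ.* (j ℤ.* s ℤ.+ + 1)) ℤ.* binom (2 ℕ.* m ℕ.+ 1) i
          ℤ.* L ((+ (2 ℕ.* m ℕ.+ 1) ℤ.- + 2 ℤ.* + i) ℤ.* j ℤ.* r) ℤ.^ n
          ℤ.* F ((+ (2 ℕ.* m ℕ.+ 1) ℤ.- + 2 ℤ.* + i) ℤ.* (j ℤ.* r ℤ.* + n ℤ.+ j ℤ.* s)))))
  × (¬ (+ 2 ℤD.∣ j ℤ.* r) → 2 ℕD.∣ n →
      toℚ (sumTo n (λ k → binom n k ℤ.* F (j ℤ.* (+ 2 ℤ.* r ℤ.* + k ℤ.+ s)) ℤ.^ (2 ℕ.* m ℕ.+ 1)))
      ≡ pow5 (+ (n ℕ./ 2) ℤ.- + m) ℚ.* toℚ (sumTo m (λ i →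
          neg1^ (+ i ℤ.* (j ℤ.* s ℤ.+ + 1)) ℤ.* binom (2 ℕ.* m ℕ.+ 1) i
          ℤ.* F ((+ (2 ℕ.* m ℕ.+ 1) ℤ.- + 2 ℤ.* + i) ℤ.* j ℤ.* r) ℤ.^ n
          ℤ.* F ((+ (2 ℕ.* m ℕ.+ 1) ℤ.- + 2 ℤ.* + i) ℤ.* (j ℤ.* r ℤ.* + n ℤ.+ j ℤ.* s)))))
  × (¬ (+ 2 ℤD.∣ j ℤ.* r) → ¬ (2 ℕD.∣ n) →
      toℚ (sumTo n (λ k → binom n k ℤ.* F (j ℤ.* (+ 2 ℤ.* r ℤ.* + k ℤ.+ s)) ℤ.^ (2 ℕ.* m ℕ.+ 1)))
      ≡ pow5 (+ ((n ℕ.∸ 1) ℕ./ 2) ℤ.- + m) ℚ.* toℚ (sumTo m (λ i →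
          neg1^ (+ i ℤ.* (j ℤ.* s ℤ.+ + 1)) ℤ.* binom (2 ℕ.* m ℕ.+ 1) i
          ℤ.* F ((+ (2 ℕ.* m ℕ.+ 1) ℤ.- + 2 ℤ.* + i) ℤ.* j ℤ.* r) ℤ.^ n
          ℤ.* L ((+ (2 ℕ.* m ℕ.+ 1) ℤ.- + 2 ℤ.* + i) ℤ.* (j ℤ.* r ℤ.* + n ℤ.+ j ℤ.* s))))))
  -- Lucas sum
  × ((+ 2 ℤD.∣ j ℤ.* r →
      toℚ (sumTo n (λ k → binom n k ℤ.* L (j ℤ.* (+ 2 ℤ.* r ℤ.* + k ℤ.+ s)) ℤ.^ (2 ℕ.* m ℕ.+ 1)))
      ≡ toℚ (sumTo m (λ i →
          neg1^ (+ i ℤ.* (j ℤ.* s)) ℤ.* binom (2 ℕ.* m ℕ.+ 1) i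
          ℤ.* L ((+ (2 ℕ.* m ℕ.+ 1) ℤ.- + 2 ℤ.* + i) ℤ.* j ℤ.* r) ℤ.^ n
          ℤ.* L ((+ (2 ℕ.* m ℕ.+ 1) ℤ.- + 2 ℤ.* + i) ℤ.* (j ℤ.* r ℤ.* + n ℤ.+ j ℤ.* s)))))
  × (¬ (+ 2 ℤD.∣ j ℤ.* r) → 2 ℕD.∣ n →
      toℚ (sumTo n (λ k → binom n k ℤ.* L (j ℤ.* (+ 2 ℤ.* r ℤ.* + k ℤ.+ s)) ℤ.^ (2 ℕ.* m ℕ.+ 1)))
      ≡ pow5 (+ (n ℕ./ 2)) ℚ.* toℚ (sumTo m (λ i →
          neg1^ (+ i ℤ.* (j ℤ.* s)) ℤ.* binom (2 ℕ.* m ℕ.+ 1) i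
          ℤ.* F ((+ (2 ℕ.* m ℕ.+ 1) ℤ.- + 2 ℤ.* + i) ℤ.* j ℤ.* r) ℤ.^ n
          ℤ.* L ((+ (2 ℕ.* m ℕ.+ 1) ℤ.- + 2 ℤ.* + i) ℤ.* (j ℤ.* r ℤ.* + n ℤ.+ j ℤ.* s)))))
  × (¬ (+ 2 ℤD.∣ j ℤ.* r) → ¬ (2 ℕD.∣ n) →
      toℚ (sumTo n (λ k → binom n k ℤ.* L (j ℤ.* (+ 2 ℤ.* r ℤ.* + k ℤ.+ s)) ℤ.^ (2 ℕ.* m ℕ.+ 1)))
      ≡ pow5 (+ ((n ℕ.+ 1) ℕ./ 2)) ℚ.* toℚ (sumTo m (λ i →
          neg1^ (+ i ℤ.* (j ℤ.* s)) ℤ.* binom (2 ℕ.* m ℕ.+ 1) i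
          ℤ.* F ((+ (2 ℕ.* m ℕ.+ 1) ℤ.- + 2 ℤ.* + i) ℤ.* j ℤ.* r) ℤ.^ n
          ℤ.* F ((+ (2 ℕ.* m ℕ.+ 1) ℤ.- + 2 ℤ.* + i) ℤ.* (j ℤ.* r ℤ.* + n ℤ.+ j ℤ.* s))))))
theorem5 m n j r s =
    ( fibonacci-sum-jr-even m n j r s , fibonacci-sum-jr-odd-n-even m n j r s , fibonacci-sum-jr-odd-n-odd m n j r s )
  , ( lucas-sum-jr-even m n j r s , lucas-sum-jr-odd-n-even m n j r s , lucas-sum-jr-odd-n-odd m n j r s )
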